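{- Let $b\ge2$ be an integer with $b\equiv 180\pmod{11184810}$ and let $t$ be a positive integer with $t\equiv 171\pmod{240}$. Then the $b$-repdigit $101_b^{(t)}=101(b^t-1)/(b-1)$ is a Riesel number.
   Context: For integers $b\ge2$, $1\le k<b$, $t\ge1$, the $b$-repdigit $k_b^{(t)}$ is $k(b^t-1)/(b-1)$. A Riesel number is an odd positive integer $k$ such that $k\cdot 2^n-1$ is composite for all positive integers $n$. -}

module Defs where

open import Data.Nat using (ℕ; suc; s≤s; _*_; _∸_; _^_; _≤_; NonZero)
open import Data.Nat.DivMod using (_/_; _%_)
open import Data.Nat.Primality using (Composite)
open import Data.Product using (_×_)
open import Relation.Binary.PropositionalEquality using (_≡_)

repdigit : (k b t : ℕ) → .{{NonZero (b ∸ 1)}} → ℕ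
repdigit k b t = k * ((b ^ t ∸ 1) / (b ∸ 1))

Riesel : ℕ → Set
Riesel k = (k % 2 ≡ 1) × (1 ≤ k) × ((n : ℕ) → 1 ≤ n → Composite (k * 2 ^ n ∸ 1))

nz-pred : (b : ℕ) → 2 ≤ b → NonZero (b ∸ 1)
nz-pred .(suc (suc _)) (s≤s (s≤s _)) = _

{-# OPTIONS --safe #-}
-- The repdigit is K = 101 · R_t(b) with R_t(b) = 1 + b + ⋯ + b^(t−1). Every prime factor of
-- 11184810 = 2·3·5·7·13·17·241 divides 180 or has 180 of order dividing 240, so K ≡ K₀ := 101 · R_171(180)
-- modulo 11184810; in particular K is odd. Since 3·5·7·13·17·241 = (2^24 − 1)/3, modulo each of these
-- primes K·2^n − 1 ≡ K₀·2^(n mod 24) − 1, and a finite check shows that for every residue j mod 24 one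
-- of them divides K₀·2^j − 1. That prime is then a proper divisor of K·2^n − 1.
module Submission where

open import Defs
open import Data.List using (List; []; _∷_)
open import Data.List.Relation.Unary.Any using (Any; any?; satisfied)
open import Data.Nat using (ℕ; zero; suc; _+_; _*_; _∸_; _^_; _≤_; _<_; _/_; _%_; z≤n; s≤s; NonZero; n>1⇒nonTrivial)
open import Data.Nat.DivMod
  using (m≡m%n+[m/n]*n; m*n/n≡m; m%n<n; m%n≤m; m∣n⇒o%n%m≡o%m; %-distribˡ-+; %-distribˡ-*; %-remove-+ʳ)
open import Data.Nat.Divisibility
open import Data.Nat.Primality using (Composite; composite)
open import Data.Nat.Properties
open import Data.Nat.Tactic.RingSolver using (solve-∀)
open import Data.Product using (_×_; _,_; ∃)
open import Relation.Binary.PropositionalEquality using (_≡_; refl; sym; trans; cong; cong₂; subst; module ≡-Reasoning)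
open import Relation.Nullary.Decidable using (Dec; from-yes; _×-dec_)

open ≡-Reasoning

repunit : ℕ → ℕ → ℕ
repunit b zero    = 0
repunit b (suc n) = 1 + b * repunit b n

repunit-geometric : ∀ c n → repunit (suc c) n * c + 1 ≡ suc c ^ n
repunit-geometric c zero    = refl
repunit-geometric c (suc n) = begin
  (1 + suc c * r) * c + 1  ≡⟨ rearrange c r ⟩
  suc c * (r * c + 1)      ≡⟨ cong (suc c *_) (repunit-geometric c n) ⟩
  suc c * suc c ^ n        ∎
  where
  r = repunit (suc c) n
  rearrange : ∀ c r → (1 + (1 + c) * r) * c + 1 ≡ (1 + c) * (r * c + 1)
  rearrange = solve-∀

repdigit≡k*repunit : ∀ k b t .{{_ : NonZero (b ∸ 1)}} → repdigit k b t ≡ k * repunit b t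
repdigit≡k*repunit k (suc c) t = cong (k *_) (begin
  (suc c ^ t ∸ 1) / c      ≡⟨ cong (λ x → (x ∸ 1) / c) (repunit-geometric c t) ⟨
  (r * c + 1 ∸ 1) / c      ≡⟨ cong (_/ c) (m+n∸n≡m (r * c) 1) ⟩
  r * c / c                ≡⟨ m*n/n≡m r c ⟩
  r                        ∎)
  where r = repunit (suc c) t

repunit-+ : ∀ b m n → repunit b (m + n) ≡ repunit b m + b ^ m * repunit b n
repunit-+ b zero    n = sym (*-identityˡ (repunit b n))
repunit-+ b (suc m) n = begin
  1 + b * repunit b (m + n)                        ≡⟨ cong (λ x → 1 + b * x) (repunit-+ b m n) ⟩
  1 + b * (repunit b m + b ^ m * repunit b n)      ≡⟨ rearrange b (repunit b m) (b ^ m) (repunit b n) ⟩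
  1 + b * repunit b m + b * b ^ m * repunit b n    ∎
  where
  rearrange : ∀ b r x s → 1 + b * (r + x * s) ≡ 1 + b * r + b * x * s
  rearrange = solve-∀

repunit∣repunit-* : ∀ b m q → repunit b m ∣ repunit b (q * m)
repunit∣repunit-* b m zero    = repunit b m ∣0
repunit∣repunit-* b m (suc q) rewrite repunit-+ b m (q * m) =
  ∣m∣n⇒∣m+n ∣-refl (∣n⇒∣m*n (b ^ m) (repunit∣repunit-* b m q))

-- A record rather than a synonym for x % m ≡ y % m, so that x, y and m are inferable from a congruence.
infix 4 _≡_mod_
record _≡_mod_ (x y m : ℕ) .{{_ : NonZero m}} : Set where
  constructor ≡-mod
  field ≡-% : x % m ≡ y % m
open _≡_mod_

module _ {m : ℕ} .{{_ : NonZero m}} where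

  +-cong-mod : ∀ {a a′ x x′} → a ≡ a′ mod m → x ≡ x′ mod m → a + x ≡ a′ + x′ mod m
  +-cong-mod {a} {a′} {x} {x′} (≡-mod a≡a′) (≡-mod x≡x′) = ≡-mod (begin
    (a + x) % m                ≡⟨ %-distribˡ-+ a x m ⟩
    (a % m + x % m) % m        ≡⟨ cong₂ (λ u v → (u + v) % m) a≡a′ x≡x′ ⟩
    (a′ % m + x′ % m) % m      ≡⟨ %-distribˡ-+ a′ x′ m ⟨
    (a′ + x′) % m              ∎)

  *-cong-mod : ∀ {a a′ x x′} → a ≡ a′ mod m → x ≡ x′ mod m → a * x ≡ a′ * x′ mod m
  *-cong-mod {a} {a′} {x} {x′} (≡-mod a≡a′) (≡-mod x≡x′) = ≡-mod (begin
    (a * x) % m                ≡⟨ %-distribˡ-* a x m ⟩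
    (a % m * (x % m)) % m      ≡⟨ cong₂ (λ u v → (u * v) % m) a≡a′ x≡x′ ⟩
    (a′ % m * (x′ % m)) % m    ≡⟨ %-distribˡ-* a′ x′ m ⟨
    (a′ * x′) % m              ∎)

  ^-≡1-mod : ∀ {a} → a ≡ 1 mod m → ∀ q → a ^ q ≡ 1 mod m
  ^-≡1-mod a≡1 zero    = ≡-mod refl
  ^-≡1-mod a≡1 (suc q) = *-cong-mod a≡1 (^-≡1-mod a≡1 q)

  ^-mod-period : ∀ {a} p .{{_ : NonZero p}} → a ^ p ≡ 1 mod m → ∀ n → a ^ n ≡ a ^ (n % p) mod m
  ^-mod-period {a} p aᵖ≡1 n = ≡-mod (begin
    a ^ n % m                              ≡⟨ cong (λ k → a ^ k % m) (m≡m%n+[m/n]*n n p) ⟩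
    a ^ (n % p + n / p * p) % m            ≡⟨ cong (_% m) (^-distribˡ-+-* a (n % p) (n / p * p)) ⟩
    (a ^ (n % p) * a ^ (n / p * p)) % m    ≡⟨ ≡-% (*-cong-mod {a = a ^ (n % p)} (≡-mod refl) full-periods≡1) ⟩
    (a ^ (n % p) * 1) % m                  ≡⟨ cong (_% m) (*-identityʳ (a ^ (n % p))) ⟩
    a ^ (n % p) % m                        ∎)
    where
    full-periods≡1 : a ^ (n / p * p) ≡ 1 mod m
    full-periods≡1 = subst (_≡ 1 mod m) (trans (^-*-assoc a p (n / p)) (cong (a ^_) (*-comm p (n / p))))
      (^-≡1-mod aᵖ≡1 (n / p))

  repunit-cong-mod : ∀ {b b′} → b ≡ b′ mod m → ∀ n → repunit b n ≡ repunit b′ n mod m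
  repunit-cong-mod b≡b′ zero    = ≡-mod refl
  repunit-cong-mod b≡b′ (suc n) = +-cong-mod (≡-mod refl) (*-cong-mod b≡b′ (repunit-cong-mod b≡b′ n))

  repunit-mod-period : ∀ b r p q → m ∣ b ^ r * repunit b p → repunit b (r + q * p) ≡ repunit b r mod m
  repunit-mod-period b r p q m∣bʳRₚ = ≡-mod (begin
    repunit b (r + q * p) % m                           ≡⟨ cong (_% m) (repunit-+ b r (q * p)) ⟩
    (repunit b r + b ^ r * repunit b (q * p)) % m       ≡⟨ %-remove-+ʳ (repunit b r) m∣bʳRqp ⟩
    repunit b r % m                                     ∎)
    where
    m∣bʳRqp : m ∣ b ^ r * repunit b (q * p)
    m∣bʳRqp = ∣-trans m∣bʳRₚ (*-monoʳ-∣ (b ^ r) (repunit∣repunit-* b p q))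

  repunit-mod-reduce : ∀ {b b₀ t r} p .{{_ : NonZero p}} → b ≡ b₀ mod m → t % p ≡ r →
                       m ∣ b₀ ^ r * repunit b₀ p → repunit b t ≡ repunit b₀ r mod m
  repunit-mod-reduce {b} {b₀} {t} {r} p b≡b₀ t%p≡r m∣b₀ʳRₚ = ≡-mod (begin
    repunit b t % m                    ≡⟨ ≡-% (repunit-cong-mod b≡b₀ t) ⟩
    repunit b₀ t % m                   ≡⟨ cong (λ k → repunit b₀ k % m) t≡r+qp ⟩
    repunit b₀ (r + t / p * p) % m     ≡⟨ ≡-% (repunit-mod-period b₀ r p (t / p) m∣b₀ʳRₚ) ⟩
    repunit b₀ r % m                   ∎)
    where
    t≡r+qp : t ≡ r + t / p * p
    t≡r+qp = trans (m≡m%n+[m/n]*n t p) (cong (_+ t / p * p) t%p≡r)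

  mod-∣ : ∀ {d x y} .{{_ : NonZero d}} → d ∣ m → x ≡ y mod m → x ≡ y mod d
  mod-∣ {d} {x} {y} d∣m (≡-mod x≡y) = ≡-mod (begin
    x % d        ≡⟨ m∣n⇒o%n%m≡o%m d m x d∣m ⟨
    x % m % d    ≡⟨ cong (_% d) x≡y ⟩
    y % m % d    ≡⟨ m∣n⇒o%n%m≡o%m d m y d∣m ⟩
    y % d        ∎)

  ∣∸1⇒≡1-mod : ∀ {y} → 1 ≤ y → m ∣ y ∸ 1 → y ≡ 1 mod m
  ∣∸1⇒≡1-mod {suc y} _ m∣y = ≡-mod (%-remove-+ʳ 1 m∣y)

  %≡1⇒∣∸1 : ∀ x → x % m ≡ 1 → m ∣ x ∸ 1
  %≡1⇒∣∸1 x x%m≡1 = divides (x / m) (begin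
    x ∸ 1                     ≡⟨ cong (_∸ 1) (m≡m%n+[m/n]*n x m) ⟩
    x % m + x / m * m ∸ 1     ≡⟨ cong (λ r → r + x / m * m ∸ 1) x%m≡1 ⟩
    x / m * m                 ∎)

∣∸1-resp-mod : ∀ {m d x y} .{{_ : NonZero m}} → 1 < d → d ∣ m → x ≡ y mod m → 1 ≤ y → d ∣ y ∸ 1 → d ∣ x ∸ 1
∣∸1-resp-mod {x = x} (s≤s (s≤s _)) d∣m x≡y 1≤y d∣y∸1 =
  %≡1⇒∣∸1 x (trans (≡-% (mod-∣ d∣m x≡y)) (≡-% (∣∸1⇒≡1-mod 1≤y d∣y∸1)))

K₀ : ℕ
K₀ = 101 * repunit 180 171

coveringSet : List ℕ
coveringSet = 3 ∷ 5 ∷ 7 ∷ 13 ∷ 17 ∷ 241 ∷ []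

CoveredBy : ℕ → ℕ → Set
CoveredBy j p = 1 < p × p ≤ 241 × p ∣ 5592405 × p ∣ K₀ * 2 ^ j ∸ 1

covering : ∀ {j} → j < 24 → Any (CoveredBy j) coveringSet
covering = from-yes (allUpTo? (λ j → any? (CoveredBy? j) coveringSet) 24)
  where
  CoveredBy? : ∀ j p → Dec (CoveredBy j p)
  CoveredBy? j p = 1 <? p ×-dec p ≤? 241 ×-dec p ∣? 5592405 ×-dec p ∣? K₀ * 2 ^ j ∸ 1

module _ {b t : ℕ} (b≡180 : b % 11184810 ≡ 180) (t≡171 : t % 240 ≡ 171) where

  K≡K₀ : 101 * repunit b t ≡ K₀ mod 11184810
  K≡K₀ = *-cong-mod {a = 101} {a′ = 101} {x = repunit b t} {x′ = repunit 180 171} (≡-mod refl)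
    (repunit-mod-reduce {b = b} {b₀ = 180} {t = t} {r = 171} 240 (≡-mod b≡180) t≡171
      (m%n≡0⇒n∣m (180 ^ 171 * repunit 180 240) 11184810 refl))

  K-odd : 101 * repunit b t % 2 ≡ 1
  K-odd = ≡-% (mod-∣ {d = 2} (divides 5592405 refl) K≡K₀)

  243≤K : 243 ≤ 101 * repunit b t
  243≤K = ≤-trans (from-yes (243 ≤? K₀ % 11184810))
    (subst (_≤ 101 * repunit b t) (≡-% K≡K₀) (m%n≤m _ 11184810))

  K2ⁿ≡K₀2ʲ : ∀ n → 101 * repunit b t * 2 ^ n ≡ K₀ * 2 ^ (n % 24) mod 5592405
  K2ⁿ≡K₀2ʲ n = *-cong-mod {a = 101 * repunit b t} {a′ = K₀} {x = 2 ^ n} {x′ = 2 ^ (n % 24)}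
    (mod-∣ (divides 2 refl) K≡K₀) (^-mod-period {a = 2} 24 (≡-mod refl) n)

  243≤K2ⁿ : ∀ n → 243 ≤ 101 * repunit b t * 2 ^ n
  243≤K2ⁿ n = ≤-trans 243≤K (m≤m*n _ (2 ^ n) {{m^n≢0 2 n}})

  composite-K2ⁿ∸1 : ∀ n → Composite (101 * repunit b t * 2 ^ n ∸ 1)
  composite-K2ⁿ∸1 n = covered⇒composite (satisfied (covering (m%n<n n 24)))
    where
    covered⇒composite : ∃ (CoveredBy (n % 24)) → Composite (101 * repunit b t * 2 ^ n ∸ 1)
    covered⇒composite (p , 1<p , p≤241 , p∣M , p∣K₀2ʲ∸1) =
      composite (≤-trans (s≤s p≤241) (∸-monoˡ-≤ 1 (243≤K2ⁿ n)))
                (∣∸1-resp-mod 1<p p∣M (K2ⁿ≡K₀2ʲ n) 1≤K₀2ʲ p∣K₀2ʲ∸1)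
      where
      instance _ = n>1⇒nonTrivial 1<p
      1≤K₀2ʲ : 1 ≤ K₀ * 2 ^ (n % 24)
      1≤K₀2ʲ = *-mono-≤ {1} {K₀} (s≤s z≤n) (m^n>0 2 (n % 24))

  riesel-101-repunit : Riesel (101 * repunit b t)
  riesel-101-repunit = K-odd , ≤-trans (s≤s z≤n) 243≤K , λ n _ → composite-K2ⁿ∸1 n

theorem3p10 : (b t : ℕ) → (hb : 2 ≤ b) → b % 11184810 ≡ 180 → 1 ≤ t → t % 240 ≡ 171 →
    Riesel (repdigit 101 b t {{nz-pred b hb}})
theorem3p10 b t hb b≡180 _ t≡171 =
  subst Riesel (sym (repdigit≡k*repunit 101 b t {{nz-pred b hb}})) (riesel-101-repunit {b} {t} b≡180 t≡171)
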